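{- Let $l$ be a complete distributive lattice, $\Sigma$ a finite alphabet, $k\ge2$, and let $f_1,\ldots,f_k:\Sigma^{\omega}\to l$ each be accepted by some $l$-valued deterministic Rabin automaton. Then the pointwise join $f_1\cup\cdots\cup f_k$ is also accepted by some $l$-valued deterministic Rabin automaton.
   Context: An $l$-valued deterministic Rabin automaton is $\mathcal A=(Q,\Sigma,\delta,q_0,\mathcal F)$ with finite $Q$, $\delta:Q\times\Sigma\to Q$, $q_0\in Q$, $\mathcal F:2^Q\times2^Q\to l$. For $w=A_0A_1\cdots\in\Sigma^\omega$ with run $q_{i+1}=\delta(q_i,A_i)$, the accepted language is $L_\omega(\mathcal A)(w)=\bigvee\{\mathcal F(H,K):(\exists n\,\forall m\ge n.\ q_m\notin H)\wedge(\forall n\,\exists m\ge n.\ q_m\in K)\}$; $f$ is accepted by $\mathcal A$ if $f=L_\omega(\mathcal A)$. $(f\cup g)(w)=f(w)\vee g(w)$. -}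

module Defs where

open import Level using (Level; _⊔_) renaming (suc to lsuc; zero to lzero)
open import Data.Empty using (⊥)
open import Data.Nat using (ℕ; zero; suc; _≥_)
open import Data.Fin using (Fin)
import Data.Fin as F
open import Data.Fin.Subset using (Subset; _∈_; _∉_)
open import Data.Product using (Σ; _×_; _,_; ∃-syntax)
open import Relation.Binary.Lattice.Bundles using (DistributiveLattice)

-- A complete distributive lattice: a (binary-)distributive lattice
-- (stdlib, order-theoretic) together with joins of arbitrary
-- (Set-indexed) families, characterised as least upper bounds.
record CompleteDistributiveLattice c ℓ₁ ℓ₂ : Set (lsuc (c ⊔ ℓ₁ ⊔ ℓ₂)) where
  field
    distributiveLattice : DistributiveLattice c ℓ₁ ℓ₂
  open DistributiveLattice distributiveLattice public
  field
    ⋁        : {I : Set} → (I → Carrier) → Carrier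
    ⋁-upper  : {I : Set} (g : I → Carrier) (i : I) → g i ≤ ⋁ g
    ⋁-least  : {I : Set} (g : I → Carrier) (x : Carrier) →
               (∀ i → g i ≤ x) → ⋁ g ≤ x

Word : Set → Set
Word Σ = ℕ → Σ

module _ {c ℓ₁ ℓ₂ : Level} (L : CompleteDistributiveLattice c ℓ₁ ℓ₂) where
  open CompleteDistributiveLattice L

  -- l-valued deterministic Rabin automaton with state set Fin n
  -- (a finite set Q, up to renaming) over the alphabet Σ.
  record DRA (Σ : Set) : Set c where
    field
      n   : ℕ
      δ   : Fin n → Σ → Fin n
      q₀  : Fin n
      Acc : Subset n → Subset n → Carrier

  run : {Σ : Set} (A : DRA Σ) → Word Σ → ℕ → Fin (DRA.n A)
  run A w zero    = DRA.q₀ A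
  run A w (suc i) = DRA.δ A (run A w i) (w i)

  RabinCond : {Σ : Set} (A : DRA Σ) → Word Σ →
              Subset (DRA.n A) × Subset (DRA.n A) → Set
  RabinCond A w (H , K) =
    (∃[ i ] (∀ m → m ≥ i → run A w m ∉ H)) ×
    (∀ i → ∃[ m ] (m ≥ i × run A w m ∈ K))

  Lω : {Σ : Set} (A : DRA Σ) → Word Σ → Carrier
  Lω A w = ⋁ {I = Σ (Subset (DRA.n A) × Subset (DRA.n A)) (RabinCond A w)}
             (λ { ((H , K) , _) → DRA.Acc A H K })

  AcceptedBy : {Σ : Set} → (Word Σ → Carrier) → DRA Σ → Set ℓ₁
  AcceptedBy f A = ∀ w → f w ≈ Lω A w

  DRAAcceptable : {Σ : Set} → (Word Σ → Carrier) → Set (c ⊔ ℓ₁)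
  DRAAcceptable {Al} f = Σ (DRA Al) (AcceptedBy f)

  _∪_ : {Σ : Set} → (Word Σ → Carrier) → (Word Σ → Carrier) → Word Σ → Carrier
  (f ∪ g) w = f w ∨ g w

  -- f₁ ∪ ⋯ ∪ f_k (right-nested); the k = 0 case (empty join) is never
  -- used by the statement since k ≥ 2 there.
  ⋃ : {Σ : Set} (k : ℕ) → (Fin k → Word Σ → Carrier) → Word Σ → Carrier
  ⋃ zero          f w = ⋁ {I = ⊥} (λ ())
  ⋃ (suc zero)    f   = f F.zero
  ⋃ (suc (suc k)) f   = f F.zero ∪ ⋃ (suc k) (λ i → f (F.suc i))

-- Run A and B in parallel on Fin (nA * nB). The projections onto the
-- components commute with the transitions, so the product's run lies in the
-- preimage of a state set exactly when the component's run lies in the set;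
-- Rabin pairs of a component therefore correspond to preimage Rabin pairs of
-- the product. Giving the product the join of the two pulled-back acceptance
-- functions yields L_ω(A ⊗ B) = L_ω(A) ∨ L_ω(B), because ⋁ commutes with ∨.
module Submission where

open import Defs
open import Level using (Level)
open import Data.Nat using (ℕ; zero; suc; _≤_; _*_)
open import Data.Fin using (Fin; zero; suc; combine; remQuot)
open import Data.Fin.Properties using (remQuot-combine)
open import Data.Fin.Subset using (Subset; _∈_)
open import Data.Vec using (tabulate; lookup)
open import Data.Vec.Properties using (lookup∘tabulate; []=⇒lookup; lookup⇒[]=)
open import Data.Product using (_×_; _,_; proj₁; proj₂; Σ-syntax)
open import Function using (_⇔_; mk⇔; Equivalence)
open import Relation.Binary.PropositionalEquality
  using (_≡_; refl; cong; module ≡-Reasoning)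
import Relation.Binary.PropositionalEquality as ≡
import Relation.Binary.Lattice.Properties.JoinSemilattice as JoinSemilatticeProperties

preimage : {m n : ℕ} → (Fin m → Fin n) → Subset n → Subset m
preimage h X = tabulate (λ q → lookup X (h q))

∈-preimage : {m n : ℕ} (h : Fin m → Fin n) (X : Subset n) (q : Fin m) →
             q ∈ preimage h X ⇔ h q ∈ X
∈-preimage h X q = mk⇔
  (λ q∈ → lookup⇒[]= (h q) X (≡.trans (≡.sym (lookup∘tabulate _ q)) ([]=⇒lookup q∈)))
  (λ hq∈ → lookup⇒[]= q (preimage h X) (≡.trans (lookup∘tabulate _ q) ([]=⇒lookup hq∈)))

module _ {c ℓ₁ ℓ₂ : Level} (L : CompleteDistributiveLattice c ℓ₁ ℓ₂) where
  open CompleteDistributiveLattice L hiding (refl) renaming (trans to ≤-trans)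
  open JoinSemilatticeProperties joinSemilattice using (∨-monotonic; ∨-cong)

  ⋁-distrib-∨ : {I : Set} (g h : I → Carrier) → ⋁ (λ i → g i ∨ h i) ≈ ⋁ g ∨ ⋁ h
  ⋁-distrib-∨ g h = antisym
    (⋁-least _ _ λ i → ∨-monotonic (⋁-upper g i) (⋁-upper h i))
    (∨-least (⋁-least _ _ λ i → ≤-trans (x≤x∨y (g i) (h i)) (⋁-upper _ i))
             (⋁-least _ _ λ i → ≤-trans (y≤x∨y (g i) (h i)) (⋁-upper _ i)))

  module _ {Σ : Set} where
    open DRA

    Acceptance : DRA L Σ → Set c
    Acceptance A = Subset (n A) → Subset (n A) → Carrier

    LωWith : (A : DRA L Σ) → Acceptance A → Word Σ → Carrier
    LωWith A g w = ⋁ {I = Σ[ HK ∈ Subset (n A) × Subset (n A) ] RabinCond L A w HK}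
                     (λ { ((H , K) , _) → g H K })

    LωWith-∨ : (A : DRA L Σ) (g g′ : Acceptance A) (w : Word Σ) →
               LωWith A (λ H K → g H K ∨ g′ H K) w ≈ LωWith A g w ∨ LωWith A g′ w
    LωWith-∨ A g g′ w = ⋁-distrib-∨ _ _

    RabinCond-transfer : (A B : DRA L Σ) (w : Word Σ)
      {H K : Subset (n A)} {H′ K′ : Subset (n B)} →
      (∀ m → run L B w m ∈ H′ → run L A w m ∈ H) →
      (∀ m → run L A w m ∈ K → run L B w m ∈ K′) →
      RabinCond L A w (H , K) → RabinCond L B w (H′ , K′)
    RabinCond-transfer A B w reflectH preserveK ((i , avoidH) , visitK) =
      (i , λ m m≥i inH′ → avoidH m m≥i (reflectH m inH′)) ,
      λ j → let (m , m≥j , inK) = visitK j in m , m≥j , preserveK m inK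

    record Hom (P A : DRA L Σ) : Set where
      field
        map    : Fin (n P) → Fin (n A)
        map-q₀ : map (q₀ P) ≡ q₀ A
        map-δ  : ∀ q a → map (δ P q a) ≡ δ A (map q) a

    -- A join, since distinct pairs of the target may have the same preimages.
    pullback : {m : ℕ} (A : DRA L Σ) → (Fin m → Fin (n A)) → Acceptance A →
               Subset m → Subset m → Carrier
    pullback A h g H K =
      ⋁ {I = Σ[ HK ∈ Subset (n A) × Subset (n A) ]
               (H ≡ preimage h (proj₁ HK) × K ≡ preimage h (proj₂ HK))}
        (λ { ((H₁ , K₁) , _) → g H₁ K₁ })

    module _ {P A : DRA L Σ} (h : Hom P A) (w : Word Σ) where
      open Hom h

      map-run : ∀ i → map (run L P w i) ≡ run L A w i
      map-run zero    = map-q₀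
      map-run (suc i) = begin
        map (δ P (run L P w i) (w i))  ≡⟨ map-δ _ (w i) ⟩
        δ A (map (run L P w i)) (w i)  ≡⟨ cong (λ q → δ A q (w i)) (map-run i) ⟩
        δ A (run L A w i) (w i)        ∎
        where open ≡-Reasoning

      run-∈-preimage : ∀ X i → run L P w i ∈ preimage map X ⇔ run L A w i ∈ X
      run-∈-preimage X i =
        ≡.subst (λ q → run L P w i ∈ preimage map X ⇔ q ∈ X) (map-run i) (∈-preimage map X _)

      RabinCond-preimage : ∀ H K →
        RabinCond L P w (preimage map H , preimage map K) ⇔ RabinCond L A w (H , K)
      RabinCond-preimage H K = mk⇔
        (RabinCond-transfer P A w (λ i → from (run-∈-preimage H i)) (λ i → to (run-∈-preimage K i)))
        (RabinCond-transfer A P w (λ i → to (run-∈-preimage H i)) (λ i → from (run-∈-preimage K i)))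
        where open Equivalence

      LωWith-pullback : (g : Acceptance A) → LωWith P (pullback A map g) w ≈ LωWith A g w
      LωWith-pullback g = antisym
        (⋁-least _ _ λ { ((H , K) , cond) → ⋁-least _ _ λ { ((H₁ , K₁) , refl , refl) →
          ⋁-upper _ ((H₁ , K₁) , Equivalence.to (RabinCond-preimage H₁ K₁) cond) } })
        (⋁-least _ _ λ { ((H , K) , cond) → ≤-trans
          (⋁-upper (λ { ((H₁ , K₁) , _) → g H₁ K₁ }) ((H , K) , refl , refl))
          (⋁-upper _ ((preimage map H , preimage map K) ,
                      Equivalence.from (RabinCond-preimage H K) cond)) })

    module _ (A B : DRA L Σ) where
      π₁ : Fin (n A * n B) → Fin (n A)
      π₁ q = proj₁ (remQuot (n B) q)

      π₂ : Fin (n A * n B) → Fin (n B)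
      π₂ q = proj₂ (remQuot {n A} (n B) q)

    _⊗_ : DRA L Σ → DRA L Σ → DRA L Σ
    A ⊗ B = record
      { n   = n A * n B
      ; δ   = λ q a → combine (δ A (π₁ A B q) a) (δ B (π₂ A B q) a)
      ; q₀  = combine (q₀ A) (q₀ B)
      ; Acc = λ H K → pullback A (π₁ A B) (Acc A) H K ∨ pullback B (π₂ A B) (Acc B) H K
      }

    module _ (A B : DRA L Σ) where
      π₁-hom : Hom (A ⊗ B) A
      π₁-hom = record
        { map    = π₁ A B
        ; map-q₀ = cong proj₁ (remQuot-combine (q₀ A) (q₀ B))
        ; map-δ  = λ q a → cong proj₁ (remQuot-combine {n A} {n B} (δ A (π₁ A B q) a) _)
        }

      π₂-hom : Hom (A ⊗ B) B
      π₂-hom = record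
        { map    = π₂ A B
        ; map-q₀ = cong proj₂ (remQuot-combine (q₀ A) (q₀ B))
        ; map-δ  = λ q a → cong proj₂ (remQuot-combine {n A} {n B} _ (δ B (π₂ A B q) a))
        }

      Lω-⊗ : ∀ w → Lω L (A ⊗ B) w ≈ Lω L A w ∨ Lω L B w
      Lω-⊗ w = Eq.trans (LωWith-∨ (A ⊗ B) _ _ w)
        (∨-cong (LωWith-pullback π₁-hom w (Acc A)) (LωWith-pullback π₂-hom w (Acc B)))

    ∪-acceptable : {f g : Word Σ → Carrier} →
      DRAAcceptable L f → DRAAcceptable L g → DRAAcceptable L (_∪_ L f g)
    ∪-acceptable (A , f≈) (B , g≈) =
      A ⊗ B , λ w → Eq.trans (∨-cong (f≈ w) (g≈ w)) (Eq.sym (Lω-⊗ A B w))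

    ⋃-acceptable : (k : ℕ) (f : Fin (suc k) → Word Σ → Carrier) →
      (∀ i → DRAAcceptable L (f i)) → DRAAcceptable L (⋃ L (suc k) f)
    ⋃-acceptable zero    f acc = acc zero
    ⋃-acceptable (suc k) f acc =
      ∪-acceptable (acc zero) (⋃-acceptable k (λ i → f (suc i)) (λ i → acc (suc i)))

proposition10 : {c ℓ₁ ℓ₂ : Level} (L : CompleteDistributiveLattice c ℓ₁ ℓ₂)
    (m : ℕ) (k : ℕ) → 2 ≤ k →
    (f : Fin k → Word (Fin m) → CompleteDistributiveLattice.Carrier L) →
    (∀ i → DRAAcceptable L (f i)) →
    DRAAcceptable L (⋃ L k f)
proposition10 L m (suc k) _ f acc = ⋃-acceptable L k f acc
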